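{- Let $\mathbb P$ be a large-tree forcing notion with $2^{<\omega}\in\mathbb P$, let $c$ be a $\mathbb P\times_{\mathsf E_0}\mathbb P$-real name, $\sigma\in2^{<\omega}$, and suppose a condition $\langle R,R'\rangle\in\mathbb P\times_{\mathsf E_0}\mathbb P$ directly forces $\sigma\cdot c\ne x_{\mathrm{left}}$ (resp. $\sigma\cdot c\ne x_{\mathrm{right}}$). Then there is a condition $\langle T,T'\rangle\in\mathbb P\times_{\mathsf E_0}\mathbb P$ with $\langle T,T'\rangle\le\langle R,R'\rangle$ which directly forces $c\notin[\sigma\cdot T]$ (resp. $c\notin[\sigma\cdot T']$).
   Context: For $s,t\in 2^{<\omega}$ with $\mathrm{lh}(s)\le\mathrm{lh}(t)$, $s\cdot t$ has length $\mathrm{lh}(t)$ with $(s\cdot t)(k)=t(k)+s(k)\bmod2$ for $k<\mathrm{lh}(s)$, $=t(k)$ otherwise; if $\mathrm{lh}(s)>\mathrm{lh}(t)$, $s\cdot t=(s{\restriction}\mathrm{lh}(t))\cdot t$; $s\cdot T=\{s\cdot t:t\in T\}$; $T{\restriction}s=\{t\in T:s\subseteq t\lor t\subseteq s\}$; $[T]$ is the set of infinite branches. The stem of a perfect tree $T$ is the largest $s\in T$ with $T=T{\restriction}s$. $\mathbf{LT}$ is the set of perfect trees $T\subseteq2^{<\omega}$ for which there are nonempty strings $q^m_i$ ($m<\omega,i<2$) with $\mathrm{lh}(q^m_0)=\mathrm{lh}(q^m_1)$, $q^m_i(0)=i$, such that $T$ consists of all initial segments of strings $\mathrm{stem}(T)^\frown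 q^0_{i(0)}{}^\frown\cdots{}^\frown q^m_{i(m)}$. A large-tree forcing notion is a set $\mathbb P\subseteq\mathbf{LT}$ closed under $T\mapsto T{\restriction}u$ ($u\in T$) and $T\mapsto s\cdot T$. For $s\in 2^{<\omega}$, $T[s]=\{t\in 2^{<\omega}:s\subseteq t\lor t\subseteq s\}$. $\mathbb P\times_{\mathsf E_0}\mathbb P$ is the set of pairs $\langle T,T'\rangle$ of trees in $\mathbb P$ with $T'=\sigma\cdot T$ for some $\sigma\in2^{<\omega}$, ordered componentwise by inclusion. A $\mathbb P\times_{\mathsf E_0}\mathbb P$-real name is a system $c=\langle C^n_i:n<\omega,i<2\rangle$ of sets $C^n_i\subseteq\mathbb P\times_{\mathsf E_0}\mathbb P$ such that each $C^n_0\cup C^n_1$ is pre-dense and every element of $C^n_0$ is incompatible with every element of $C^n_1$. For $\rho\in2^{<\omega}$, $\rho\cdot c=\langle C'^n_i\rangle$ where $C'^n_i=C^n_{1-i}$ if $n<\mathrm{lh}(\rho)$ and $\rho(n)=1$, and $C'^n_i=C^n_i$ otherwise. $x_{\mathrm{left}}$ is the name $\langle C^n_i\rangle$ where $C^n_i$ is the set of all pairs $\langle T[s],T[t]\rangle$ with $s,t\in 2^{n+1}$, $s(n)=i$ (and $\langle T[s],T[t]\rangle\in\mathbb P\times_{\mathsf E_0}\mathbb P$); $x_{\mathrm{right}}$ is defined likewise with the condition $t(n)=i$. A condition $\langle T,T'\rangle$ directly forces $c(n)=i$ if $\langle T,T'\rangle\le\langle S,S'\rangle$ for some $\langle S,S'\rangle\in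 C^n_i$; directly forces $s\subset c$ if it directly forces $c(n)=s(n)$ for all $n<\mathrm{lh}(s)$; directly forces $d\ne c$ (names $c,d$) if there are $\subseteq$-incomparable $s,t\in 2^{<\omega}$ such that it directly forces $s\subset c$ and $t\subset d$; directly forces $c\notin[U]$ if for some $s\in2^{<\omega}\setminus U$ it directly forces $s\subset c$. -}

module Defs where

open import Data.Bool using (Bool; true; false; _xor_)
open import Data.Nat using (ℕ; zero; suc)
open import Data.List using (List; []; _∷_; _++_; length; concat; map)
open import Data.Vec using (Vec; toList; lookup)
open import Data.Fin using (Fin; toℕ)
open import Data.Product using (Σ; _×_; _,_; ∃; ∃-syntax)
open import Data.Sum using (_⊎_)
open import Data.Unit using (⊤)
open import Relation.Nullary using (¬_)
open import Relation.Binary.PropositionalEquality using (_≡_; _≢_)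

Str : Set
Str = List Bool

_⊑_ : Str → Str → Set
s ⊑ t = ∃[ u ] (s ++ u ≡ t)

_·_ : Str → Str → Str
[] · t = t
(a ∷ s) · [] = []
(a ∷ s) · (b ∷ t) = (b xor a) ∷ (s · t)

-- a (candidate) tree: a subset of 2^{<ω}, as a predicate
Tree : Set₁
Tree = Str → Set

_⊆T_ : Tree → Tree → Set
T ⊆T S = ∀ u → T u → S u

_≐_ : Tree → Tree → Set
T ≐ S = (T ⊆T S) × (S ⊆T T)

_·T_ : Str → Tree → Tree
(s ·T T) u = ∃[ t ] (T t × s · t ≡ u)

_↾_ : Tree → Str → Tree
(T ↾ s) t = T t × (s ⊑ t ⊎ t ⊑ s)

T[_] : Str → Tree
T[ s ] t = s ⊑ t ⊎ t ⊑ s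

Full : Tree
Full _ = ⊤

blocks : (ℕ → Bool → Str) → (m : ℕ) → Vec Bool (suc m) → Str
blocks q m i = go 0 (toList i)
  where
  go : ℕ → List Bool → Str
  go k [] = []
  go k (b ∷ bs) = q k b ++ go (suc k) bs

LT : Tree → Set
LT T =
  Σ Str λ stem → Σ (ℕ → Bool → Str) λ q →
    (∀ m i → q m i ≢ [])
  × (∀ m → length (q m false) ≡ length (q m true))
  × (∀ m i → ∃[ r ] (q m i ≡ i ∷ r))
  × (∀ u → T u → ∃[ m ] ∃[ i ] (u ⊑ (stem ++ blocks q m i)))
  × (∀ u → (∃[ m ] ∃[ i ] (u ⊑ (stem ++ blocks q m i))) → T u)

-- large-tree forcing notion.  Since trees are predicates, we also record that
-- membership respects extensional equality (automatic for sets).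
record LargeTreeForcing (P : Tree → Set) : Set₁ where
  field
    respects : ∀ {T S} → T ≐ S → P T → P S
    large    : ∀ T → P T → LT T
    restr    : ∀ T u → P T → T u → P (T ↾ u)
    shift    : ∀ T s → P T → P (s ·T T)

Cond : Set₁
Cond = Tree × Tree

module _ (P : Tree → Set) where

  InPE0 : Cond → Set
  InPE0 (T , T') = P T × P T' × ∃[ σ ] (T' ≐ (σ ·T T))

  _≤_ : Cond → Cond → Set
  (T , T') ≤ (S , S') = (T ⊆T S) × (T' ⊆T S')

  Compatible : Cond → Cond → Set₁
  Compatible p q = ∃[ r ] (InPE0 r × r ≤ p × r ≤ q)


  System : Set₁
  System = ℕ → Bool → Cond → Set

  IsName : System → Set₁
  IsName C =
      (∀ n i p → C n i p → InPE0 p)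
    × (∀ n p → InPE0 p → ∃[ q ] ((C n false q ⊎ C n true q) × Compatible p q))
    × (∀ n p q → C n false p → C n true q → ¬ Compatible p q)

  -- bit of ρ at n (false if n ≥ lh ρ)
  bitAt : Str → ℕ → Bool
  bitAt [] n = false
  bitAt (b ∷ ρ) zero = b
  bitAt (b ∷ ρ) (suc n) = bitAt ρ n

  act : Str → System → System
  act ρ C n i = C n (i xor bitAt ρ n)

  xLeft : System
  xLeft n i p = Σ (Vec Bool (suc n)) λ s → Σ (Vec Bool (suc n)) λ t →
    (lookup s (Data.Fin.fromℕ n) ≡ i) × InPE0 p
    × (Data.Product.proj₁ p ≐ T[ toList s ]) × (Data.Product.proj₂ p ≐ T[ toList t ])

  xRight : System
  xRight n i p = Σ (Vec Bool (suc n)) λ s → Σ (Vec Bool (suc n)) λ t →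
    (lookup t (Data.Fin.fromℕ n) ≡ i) × InPE0 p
    × (Data.Product.proj₁ p ≐ T[ toList s ]) × (Data.Product.proj₂ p ≐ T[ toList t ])

  DF-bit : Cond → System → ℕ → Bool → Set₁
  DF-bit p C n i = ∃[ q ] (C n i q × p ≤ q)

  DF-init : Cond → System → Str → Set₁
  DF-init p C s = (k : Fin (length s)) → DF-bit p C (toℕ k) (Data.List.lookup s k)

  DF-neq : Cond → System → System → Set₁
  DF-neq p C D = ∃[ s ] ∃[ t ] (¬ (s ⊑ t) × ¬ (t ⊑ s) × DF-init p C s × DF-init p D t)

  DF-notin : Cond → System → Tree → Set₁
  DF-notin p C U = ∃[ s ] (¬ U s × DF-init p C s)

module Submission where

-- Suppose ⟨R,R'⟩ directly forces σ·c ≠ x_left, witnessed by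
-- ⊆-incomparable strings s, t with ⟨R,R'⟩ directly forcing s ⊂ σ·c and
-- t ⊂ x_left.  No shrinking is needed: ⟨T,T'⟩ = ⟨R,R'⟩ already works.
--   * Forcing t ⊂ x_left pins down the left tree: for every k < lh t there is
--     a string w with w(k) = t(k) and R ⊆ T[w].  Hence every u ∈ R agrees with
--     t wherever both are defined.
--   * Since s and t are incomparable they differ at some position, so s ∉ R,
--     and therefore σ·s ∉ σ·R (the action of σ on strings is injective).
--   * Forcing s ⊂ σ·c is the same as forcing σ·s ⊂ c, because
--     (σ·c)(n) = c(n) xor σ(n).
-- So ⟨R,R'⟩ directly forces c ∉ [σ·R].  The case of x_right is symmetric,
-- with the right tree R' pinned down instead.

open import Defs
open import Data.Bool using (Bool; not; _xor_; _≟_)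
open import Data.Bool.Properties using (¬-not; not-¬; xor-assoc; xor-same; xor-identityʳ)
open import Data.Nat using (ℕ; zero; suc)
open import Data.List using ([]; _∷_; _++_; length; lookup)
open import Data.List.Properties using (∷-injective)
open import Data.Vec using (Vec; toList) renaming (_∷_ to _∷v_; [] to []v; lookup to vlookup)
open import Data.Fin using (Fin; toℕ; fromℕ) renaming (zero to fzero; suc to fsuc)
open import Data.Maybe using (Maybe; just; nothing)
open import Data.Maybe.Properties using (just-injective)
open import Data.Product using (Σ; _×_; _,_; ∃; ∃-syntax; proj₁; proj₂)
open import Data.Sum using (inj₁; inj₂)
open import Relation.Nullary using (¬_; yes; no; contradiction)
open import Relation.Binary.PropositionalEquality
  using (_≡_; refl; sym; trans; cong; cong₂; subst; module ≡-Reasoning)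

bit : Str → ℕ → Maybe Bool
bit [] _ = nothing
bit (x ∷ s) zero = just x
bit (x ∷ s) (suc j) = bit s j

bit-++ : (s u : Str) (j : ℕ) {a : Bool} → bit s j ≡ just a → bit (s ++ u) j ≡ just a
bit-++ [] u j ()
bit-++ (x ∷ s) u zero e = e
bit-++ (x ∷ s) u (suc j) e = bit-++ s u j e

comparable-agree : (s w : Str) (j : ℕ) {a b : Bool} →
  T[ w ] s → bit s j ≡ just a → bit w j ≡ just b → a ≡ b
comparable-agree s w j (inj₁ (u , w++u≡s)) sa wb =
  just-injective (trans (sym sa) (subst (λ z → bit z j ≡ just _) w++u≡s (bit-++ w u j wb)))
comparable-agree s w j (inj₂ (u , s++u≡w)) sa wb =
  just-injective (trans (sym (subst (λ z → bit z j ≡ just _) s++u≡w (bit-++ s u j sa))) wb)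

diverge : (s t : Str) → ¬ (s ⊑ t) → ¬ (t ⊑ s) →
  ∃[ j ] ∃[ b ] (bit s j ≡ just b × bit t j ≡ just (not b))
diverge [] t s⋢t _ = contradiction (t , refl) s⋢t
diverge (a ∷ s) [] _ t⋢s = contradiction (a ∷ s , refl) t⋢s
diverge (a ∷ s) (b ∷ t) s⋢t t⋢s with a ≟ b
... | no a≢b = zero , a , refl , cong just (¬-not (λ b≡a → a≢b (sym b≡a)))
... | yes refl with diverge s t (λ (u , e) → s⋢t (u , cong (a ∷_) e))
                                 (λ (u , e) → t⋢s (u , cong (a ∷_) e))
...   | j , c , sc , tc = suc j , c , sc , tc

bit-lookup : (t : Str) (k : Fin (length t)) → bit t (toℕ k) ≡ just (lookup t k)
bit-lookup (x ∷ t) fzero = refl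
bit-lookup (x ∷ t) (fsuc k) = bit-lookup t k

position : (t : Str) (j : ℕ) {c : Bool} → bit t j ≡ just c → Σ (Fin (length t)) λ k → toℕ k ≡ j
position [] j ()
position (x ∷ t) zero _ = fzero , refl
position (x ∷ t) (suc j) e with position t j e
... | k , k≡j = fsuc k , cong suc k≡j

bit-last : (n : ℕ) (v : Vec Bool (suc n)) → bit (toList v) n ≡ just (vlookup v (fromℕ n))
bit-last zero (x ∷v []v) = refl
bit-last (suc n) (x ∷v v) = bit-last n v

-- `Pins Y j b`: the tree Y lies inside T[w] for some w with w(j) = b, so all
-- members of Y that reach length j+1 have bit b at j.
Pins : Tree → ℕ → Bool → Set
Pins Y j b = ∃[ w ] (bit w j ≡ just b × Y ⊆T T[ w ])

pinned-excludes : (Y : Tree) (s t : Str) → ¬ (s ⊑ t) → ¬ (t ⊑ s) →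
  ((k : Fin (length t)) → Pins Y (toℕ k) (lookup t k)) → ¬ Y s
pinned-excludes Y s t s⋢t t⋢s pins s∈Y with diverge s t s⋢t t⋢s
... | j , b , sb , tb with position t j tb
... | k , refl with pins k
... | w , wt , Y⊆w =
  not-¬ refl (trans (comparable-agree s w (toℕ k) (Y⊆w s s∈Y) sb wt)
                    (just-injective (trans (sym (bit-lookup t k)) tb)))

xLeft-pins : (P : Tree → Set) (p : Cond) (n : ℕ) (i : Bool) →
  DF-bit P p (xLeft P) n i → Pins (proj₁ p) n i
xLeft-pins P (R , R') n i ((Q , Q') , (v , _ , v-last , _ , Q≐v , _) , R⊆Q , _) =
  toList v , trans (bit-last n v) (cong just v-last) , λ u u∈R → proj₁ Q≐v u (R⊆Q u u∈R)

xRight-pins : (P : Tree → Set) (p : Cond) (n : ℕ) (i : Bool) →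
  DF-bit P p (xRight P) n i → Pins (proj₂ p) n i
xRight-pins P (R , R') n i ((Q , Q') , (_ , v , v-last , _ , _ , Q'≐v) , _ , R'⊆Q') =
  toList v , trans (bit-last n v) (cong just v-last) , λ u u∈R' → proj₁ Q'≐v u (R'⊆Q' u u∈R')

xor-cancelʳ : (a x y : Bool) → x xor a ≡ y xor a → x ≡ y
xor-cancelʳ a x y e = begin
  x                 ≡⟨ sym (cancel x) ⟩
  (x xor a) xor a   ≡⟨ cong (_xor a) e ⟩
  (y xor a) xor a   ≡⟨ cancel y ⟩
  y                 ∎
  where
  open ≡-Reasoning
  cancel : (z : Bool) → (z xor a) xor a ≡ z
  cancel z = trans (xor-assoc z a a) (trans (cong (z xor_) (xor-same a)) (xor-identityʳ z))

·-injective : (σ r s : Str) → σ · r ≡ σ · s → r ≡ s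
·-injective [] r s e = e
·-injective (a ∷ σ) [] [] e = refl
·-injective (a ∷ σ) (x ∷ r) (y ∷ s) e with ∷-injective e
... | head≡ , tail≡ = cong₂ _∷_ (xor-cancelʳ a x y head≡) (·-injective σ r s tail≡)

shifted-excluded : (T : Tree) (σ s : Str) → ¬ T s → ¬ (σ ·T T) (σ · s)
shifted-excluded T σ s s∉T (r , r∈T , σr≡σs) = s∉T (subst T (·-injective σ r s σr≡σs) r∈T)

-- Bit n of σ·c is bit n of c flipped by σ(n), so any per-bit property of
-- the bits of s xor σ is a property of the bits of σ·s.  Stated for an
-- arbitrary family F so that the induction can shift positions.
shift-bits : (P : Tree → Set) (F : ℕ → Bool → Set₁) (σ s : Str) →
  ((k : Fin (length s)) → F (toℕ k) (lookup s k xor bitAt P σ (toℕ k))) →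
  (k : Fin (length (σ · s))) → F (toℕ k) (lookup (σ · s) k)
shift-bits P F [] s h k = subst (F (toℕ k)) (xor-identityʳ (lookup s k)) (h k)
shift-bits P F (a ∷ σ) (b ∷ s) h fzero = h fzero
shift-bits P F (a ∷ σ) (b ∷ s) h (fsuc k) =
  shift-bits P (λ n → F (suc n)) σ s (λ k → h (fsuc k)) k

act-init : (P : Tree → Set) (p : Cond) (C : System P) (σ s : Str) →
  DF-init P p (act P σ C) s → DF-init P p C (σ · s)
act-init P p C σ s = shift-bits P (DF-bit P p C) σ s

avoid-shifted-tree : (P : Tree → Set) (p : Cond) (C D : System P) (σ : Str) (Y : Tree) →
  ((n : ℕ) (i : Bool) → DF-bit P p D n i → Pins Y n i) →
  DF-neq P p (act P σ C) D → DF-notin P p C (σ ·T Y)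
avoid-shifted-tree P p C D σ Y pins (s , t , s⋢t , t⋢s , forces-s , forces-t) =
  σ · s , shifted-excluded Y σ s s∉Y , act-init P p C σ s forces-s
  where
  s∉Y : ¬ Y s
  s∉Y = pinned-excludes Y s t s⋢t t⋢s (λ k → pins (toℕ k) (lookup t k) (forces-t k))

lemma9p2 : (P : Tree → Set) → LargeTreeForcing P → P Full →
    (C : System P) → IsName P C → (σ : Str) → (R R' : Tree) → InPE0 P (R , R') →
      (DF-neq P (R , R') (act P σ C) (xLeft P) →
         ∃[ T ] ∃[ T' ] (InPE0 P (T , T') × _≤_ P (T , T') (R , R') × DF-notin P (T , T') C (σ ·T T)))
    × (DF-neq P (R , R') (act P σ C) (xRight P) →
         ∃[ T ] ∃[ T' ] (InPE0 P (T , T') × _≤_ P (T , T') (R , R') × DF-notin P (T , T') C (σ ·T T')))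
lemma9p2 P _ _ C _ σ R R' RR'∈P =
    (λ neq → R , R' , RR'∈P , ≤-refl ,
               avoid-shifted-tree P (R , R') C (xLeft P) σ R (xLeft-pins P (R , R')) neq)
  , (λ neq → R , R' , RR'∈P , ≤-refl ,
               avoid-shifted-tree P (R , R') C (xRight P) σ R' (xRight-pins P (R , R')) neq)
  where
  ≤-refl : _≤_ P (R , R') (R , R')
  ≤-refl = (λ _ u∈R → u∈R) , (λ _ u∈R' → u∈R')
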